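{- Let $\Pi X.\,s\,[\exists\vec{x}.\varphi]$ be an existentially constrained term and $p\in\mathrm{Pos}(s)$. Let $\rho,\rho'$ be renamed variants of the same left-linear constrained rewrite rule with $\mathrm{Var}(\rho)\cap\mathrm{Var}(s,\varphi)=\emptyset$ and $\mathrm{Var}(\rho')\cap\mathrm{Var}(s,\varphi)=\emptyset$. If $\Pi X.s[\exists\vec{x}.\varphi]\to^p_{\rho}\Pi Y.t[\exists\vec{y}.\psi]$ and $\Pi X.s[\exists\vec{x}.\varphi]\to^p_{\rho'}\Pi Y'.t'[\exists\vec{y}'.\psi']$, then $\Pi Y.t[\exists\vec{y}.\psi]\sim\Pi Y'.t'[\exists\vec{y}'.\psi']$.
   Context: Fix a many-sorted signature whose sorts are partitioned into theory sorts and term sorts and whose function symbols are partitioned into theory symbols (all argument and result sorts are theory sorts) and term symbols; there is a theory sort $\mathsf{Bool}$. $\mathrm{Var}(t_1,\dots,t_n)$ is the set of variables in the $t_i$; $\mathrm{Pos}(s)$, $s|_p$, $s[u]_p$ as usual. A fixed model $\mathcal{M}$ interprets theory sorts by nonempty sets and theory symbols by functions, with $\mathsf{Bool}=\{\mathsf{true},\mathsf{false}\}$ and standard connectives and equalities; every element of every interpreted sort is a constant theory symbol, called a value; $\mathrm{Val}$ is the set of values. A logical constraint is a $\mathsf{Bool}$-sorted term of theory symbols and variables; $\models_{\mathcal{M},\xi}\varphi$ (valuation $\xi$) and $\models_{\mathcal{M}}\varphi$ (all valuations) as usual. Substitutions are sort-preserving, $\mathrm{Dom}(\sigma)=\{x\mid\sigma(x)\ne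 x\}$, $\sigma$ is $X$-valued if $\sigma(X)\subseteq\mathrm{Val}$; a renaming is a bijective variable-to-variable substitution. Existential constraint $\exists\vec x.\varphi$: $\{\vec x\}\subseteq\mathrm{Var}(\varphi)$, $\mathrm{FVar}=\mathrm{Var}(\varphi)\setminus\{\vec x\}$; $\models_{\mathcal{M},\xi}\exists\vec x.\varphi$ iff some values $\vec v$ give $\models_{\mathcal{M},\xi}\varphi\{\vec x\mapsto\vec v\}$; valid/satisfiable: for all/some $\xi$. $\sigma\models_{\mathcal{M}}\exists\vec x.\varphi$ means $\sigma(\mathrm{FVar}(\exists\vec x.\varphi))\subseteq\mathrm{Val}$ and $\models_{\mathcal{M}}(\exists\vec x.\varphi)\sigma$. An existentially constrained term $\Pi X.s[\exists\vec x.\varphi]$ requires $\mathrm{FVar}(\exists\vec x.\varphi)\subseteq X\subseteq\mathrm{Var}(s)$ and $\{\vec x\}\cap\mathrm{Var}(s)=\emptyset$; satisfiable if its constraint is. Equivalence: $\Pi X.s[\exists\vec x.\varphi]\sim\Pi Y.t[\exists\vec y.\psi]$ iff for every $X$-valued $\sigma$ with $\sigma\models_{\mathcal{M}}\exists\vec x.\varphi$ there is a $Y$-valued $\gamma$ with $\gamma\models_{\mathcal{M}}\exists\vec y.\psi$ and $s\sigma=t\gamma$, and vice versa. A constrained rewrite rule $\rho:\Pi Z.\ell\to r[\pi]$: $\ell,r$ terms of the same sort, $\pi$ a logical constraint, $(\mathrm{Var}(r)\setminus\mathrm{Var}(\ell))\cup\mathrm{Var}(\pi)\subseteq Z\subseteq\mathrm{Var}(\ell,r,\pi)=\mathrm{Var}(\rho)$;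 left-linear if $\ell$ is linear; $\mathrm{ExVar}(\rho)=\mathrm{Var}(r)\setminus\mathrm{Var}(\ell)$. A renamed variant of $\rho$ is $\Pi\delta(Z).\ell\delta\to r\delta[\pi\delta]$ for a renaming $\delta$. Most general rewrite step: for satisfiable $\Pi X.s[\exists\vec x.\varphi]$ and left-linear $\rho$ with $\mathrm{Var}(\rho)\cap\mathrm{Var}(s,\varphi)=\emptyset$, if $p\in\mathrm{Pos}(s)$ and $\gamma$ satisfy $\mathrm{Dom}(\gamma)=\mathrm{Var}(\ell)$, $s|_p=\ell\gamma$, $\gamma(x)\in\mathrm{Val}\cup X$ for all $x\in\mathrm{Var}(\ell)\cap Z$, and $\models_{\mathcal{M}}(\exists\vec x.\varphi)\Rightarrow(\exists\vec z.\pi\gamma)$ with $\{\vec z\}=\mathrm{Var}(\pi)\setminus\mathrm{Var}(\ell)$, then $\Pi X.s[\exists\vec x.\varphi]\to^p_\rho\Pi Y.t[\exists\vec y.\psi]$ with $t=s[r\gamma]_p$, $\psi=\varphi\land\pi\gamma$, $\{\vec y\}=\mathrm{Var}(\psi)\setminus\mathrm{Var}(t)$, $Y=\mathrm{ExVar}(\rho)\cup(X\cap\mathrm{Var}(t))$. -}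

module Defs where

open import Data.Bool using (Bool; true; false)
open import Data.Nat using (ℕ; zero; suc)
open import Data.List using (List; []; _∷_; _++_)
open import Data.List.Relation.Unary.All using (All; []; _∷_)
open import Data.List.Relation.Unary.Unique.Propositional using (Unique)
open import Data.List.Membership.Propositional using (_∈_; _∉_)
open import Data.Maybe using (Maybe; just; nothing)
open import Data.Product using (Σ; ∃; _×_; _,_; proj₁; proj₂)
open import Data.Sum using (_⊎_)
open import Relation.Nullary using (¬_; yes; no)
open import Relation.Binary.PropositionalEquality using (_≡_; _≢_; refl; subst; sym)
open import Relation.Binary.Definitions using (DecidableEquality)
open import Function.Definitions using (Bijective)

record Signature : Set₁ where
  field
    Sort      : Set
    isThSort  : Sort → Bool
    BoolS     : Sort
    BoolS-th  : isThSort BoolS ≡ true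
    FunSym    : Set
    arity     : FunSym → List Sort
    res       : FunSym → Sort
    isThSym   : FunSym → Bool
    thSym-sorts : ∀ f → isThSym f ≡ true →
                  All (λ σ → isThSort σ ≡ true) (arity f) × isThSort (res f) ≡ true
    andS       : FunSym
    andS-th    : isThSym andS ≡ true
    andS-arity : arity andS ≡ BoolS ∷ BoolS ∷ []
    andS-res   : res andS ≡ BoolS
    V     : Set
    vsort : V → Sort
    _≟V_  : DecidableEquality V

-- A model M.  The interpretation of a theory sort σ is the set of
-- values (constant theory symbols) of sort σ; a value is interpreted
-- as itself, any other theory symbol by 'interp'.

record Model (S : Signature) : Set where
  open Signature S
  field
    isVal     : FunSym → Bool
    val-const : ∀ v → isVal v ≡ true → isThSym v ≡ true × arity v ≡ []
    interp    : ∀ f → isThSym f ≡ true → isVal f ≡ false →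
                All (λ σ → Σ FunSym (λ v → isVal v ≡ true × res v ≡ σ)) (arity f) →
                Σ FunSym (λ v → isVal v ≡ true × res v ≡ res f)
    nonempty  : ∀ σ → isThSort σ ≡ true → Σ FunSym (λ v → isVal v ≡ true × res v ≡ σ)
    trueS falseS : FunSym
    trueS-val    : isVal trueS ≡ true
    falseS-val   : isVal falseS ≡ true
    trueS-sort   : res trueS ≡ BoolS
    falseS-sort  : res falseS ≡ BoolS
    true≢false   : trueS ≢ falseS
    bool-exhaust : ∀ v → isVal v ≡ true → res v ≡ BoolS → v ≡ trueS ⊎ v ≡ falseS
    andS-nv  : isVal andS ≡ false
    andS-sem : ∀ (a b : Σ FunSym (λ v → isVal v ≡ true × res v ≡ BoolS)) →
      (proj₁ (interp andS andS-th andS-nv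
          (subst (All (λ σ → Σ FunSym (λ v → isVal v ≡ true × res v ≡ σ)))
                 (sym andS-arity) (a ∷ b ∷ []))) ≡ trueS
        → proj₁ a ≡ trueS × proj₁ b ≡ trueS)
      × (proj₁ a ≡ trueS × proj₁ b ≡ trueS
        → proj₁ (interp andS andS-th andS-nv
          (subst (All (λ σ → Σ FunSym (λ v → isVal v ≡ true × res v ≡ σ)))
                 (sym andS-arity) (a ∷ b ∷ []))) ≡ trueS)

infix 2 _iff_
_iff_ : Set → Set → Set
A iff B = (A → B) × (B → A)

module Theory (S : Signature) (M : Model S) where
  open Signature S public
  open Model M public
  open import Data.List.Membership.DecPropositional _≟V_ using (_∈?_)

  Val : Sort → Set
  Val σ = Σ FunSym (λ v → isVal v ≡ true × res v ≡ σ)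

  IsThS : Sort → Set
  IsThS σ = isThSort σ ≡ true

  -- raw terms; well-sortedness is the predicate WS below
  data Term : Set where
    var : V → Term
    app : FunSym → List Term → Term

  data WS : Term → Sort → Set
  data WSL : List Term → List Sort → Set
  data WS where
    wvar : ∀ {x σ} → vsort x ≡ σ → WS (var x) σ
    wapp : ∀ {f ts σ} → res f ≡ σ → WSL ts (arity f) → WS (app f ts) σ
  data WSL where
    []  : WSL [] []
    _∷_ : ∀ {t ts σ σs} → WS t σ → WSL ts σs → WSL (t ∷ ts) (σ ∷ σs)

  data ThTm : Term → Sort → Set
  data ThTmL : List Term → List Sort → Set
  data ThTm where
    tvar : ∀ {x σ} → IsThS (vsort x) → vsort x ≡ σ → ThTm (var x) σ
    tapp : ∀ {f ts σ} → isThSym f ≡ true → res f ≡ σ → ThTmL ts (arity f) → ThTm (app f ts) σ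
  data ThTmL where
    []  : ThTmL [] []
    _∷_ : ∀ {t ts σ σs} → ThTm t σ → ThTmL ts σs → ThTmL (t ∷ ts) (σ ∷ σs)

  LogicalConstraint : Term → Set
  LogicalConstraint φ = ThTm φ BoolS

  -- variable occurrences (with multiplicity); x ∈ vars t  is  x ∈ Var(t)
  vars  : Term → List V
  varsL : List Term → List V
  vars (var x)    = x ∷ []
  vars (app f ts) = varsL ts
  varsL []       = []
  varsL (t ∷ ts) = vars t ++ varsL ts

  Linear : Term → Set
  Linear t = Unique (vars t)

  Subst : Set
  Subst = V → Term

  SortPres : Subst → Set
  SortPres σ = ∀ x → WS (σ x) (vsort x)

  _⟨_⟩  : Term → Subst → Term
  _⟨_⟩L : List Term → Subst → List Term
  var x ⟨ σ ⟩    = σ x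
  app f ts ⟨ σ ⟩ = app f (ts ⟨ σ ⟩L)
  [] ⟨ σ ⟩L       = []
  (t ∷ ts) ⟨ σ ⟩L = (t ⟨ σ ⟩) ∷ (ts ⟨ σ ⟩L)

  IsValTerm : Term → Set
  IsValTerm t = Σ FunSym (λ v → isVal v ≡ true × t ≡ app v [])

  Valued : (V → Set) → Subst → Set
  Valued X σ = ∀ x → X x → IsValTerm (σ x)

  Renaming : (V → V) → Set
  Renaming δ = Bijective _≡_ _≡_ δ × (∀ x → vsort (δ x) ≡ vsort x)

  -- positions (child indices counted from 0), subterm and replacement
  Pos : Set
  Pos = List ℕ

  subtermAt  : Term → Pos → Maybe Term
  subtermAtL : List Term → ℕ → Pos → Maybe Term
  subtermAt t [] = just t
  subtermAt (var x) (i ∷ p) = nothing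
  subtermAt (app f ts) (i ∷ p) = subtermAtL ts i p
  subtermAtL [] i p = nothing
  subtermAtL (t ∷ ts) zero p = subtermAt t p
  subtermAtL (t ∷ ts) (suc i) p = subtermAtL ts i p

  replaceAt  : Term → Pos → Term → Term
  replaceAtL : List Term → ℕ → Pos → Term → List Term
  replaceAt t [] u = u
  replaceAt (var x) (i ∷ p) u = var x
  replaceAt (app f ts) (i ∷ p) u = app f (replaceAtL ts i p u)
  replaceAtL [] i p u = []
  replaceAtL (t ∷ ts) zero p u = replaceAt t p u ∷ ts
  replaceAtL (t ∷ ts) (suc i) p u = t ∷ replaceAtL ts i p u

  _∈Pos_ : Pos → Term → Set
  p ∈Pos s = subtermAt s p ≢ nothing

  Valuation : Set
  Valuation = (x : V) → IsThS (vsort x) → Val (vsort x)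

  eval  : Valuation → ∀ {t σ} → ThTm t σ → Val σ
  evalL : Valuation → ∀ {ts σs} → ThTmL ts σs → All Val σs
  eval ξ (tvar {x} th eq) = subst Val eq (ξ x th)
  eval ξ (tapp {f} thf eq ds) with isVal f in e
  ... | true  = f , e , eq
  ... | false = subst Val eq (interp f thf e (evalL ξ ds))
  evalL ξ [] = []
  evalL ξ (d ∷ ds) = eval ξ d ∷ evalL ξ ds

  Holds : Valuation → Term → Set
  Holds ξ φ = Σ (ThTm φ BoolS) (λ d → proj₁ (eval ξ d) ≡ trueS)

  inst : (xs : List V) → ((x : V) → x ∈ xs → Val (vsort x)) → Subst
  inst xs vs x with x ∈? xs
  ... | yes m = app (proj₁ (vs x m)) []
  ... | no _  = var x

  HoldsEx : Valuation → List V → Term → Set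
  HoldsEx ξ xs φ = Σ ((x : V) → x ∈ xs → Val (vsort x)) (λ vs → Holds ξ (φ ⟨ inst xs vs ⟩))

  ValidEx : List V → Term → Set
  ValidEx xs φ = ∀ ξ → HoldsEx ξ xs φ

  SatisfiableEx : List V → Term → Set
  SatisfiableEx xs φ = Σ Valuation (λ ξ → HoldsEx ξ xs φ)

  without : List V → Subst → Subst
  without xs σ x with x ∈? xs
  ... | yes _ = var x
  ... | no _  = σ x

  SatBy : Subst → List V → Term → Set
  SatBy σ xs φ = (∀ x → x ∈ vars φ → x ∉ xs → IsValTerm (σ x))
               × ValidEx xs (φ ⟨ without xs σ ⟩)

  record ECT : Set₁ where
    field
      X  : V → Set
      s  : Term
      xs : List V
      φ  : Term

  WF-ECT : ECT → Set
  WF-ECT C = LogicalConstraint φ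
           × (∀ x → x ∈ xs → x ∈ vars φ)
           × (∀ x → x ∈ vars φ → x ∉ xs → X x)
           × (∀ x → X x → x ∈ vars s)
           × (∀ x → x ∈ xs → x ∉ vars s)
           × Σ Sort (λ τ → WS s τ)
    where open ECT C

  SatisfiableECT : ECT → Set
  SatisfiableECT C = SatisfiableEx (ECT.xs C) (ECT.φ C)

  _∼_ : ECT → ECT → Set
  C ∼ D = (∀ σ → SortPres σ → Valued (ECT.X C) σ → SatBy σ (ECT.xs C) (ECT.φ C) →
             Σ Subst (λ γ → SortPres γ × Valued (ECT.X D) γ × SatBy γ (ECT.xs D) (ECT.φ D)
                           × ECT.s C ⟨ σ ⟩ ≡ ECT.s D ⟨ γ ⟩))
        × (∀ γ → SortPres γ → Valued (ECT.X D) γ → SatBy γ (ECT.xs D) (ECT.φ D) →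
             Σ Subst (λ σ → SortPres σ × Valued (ECT.X C) σ × SatBy σ (ECT.xs C) (ECT.φ C)
                           × ECT.s C ⟨ σ ⟩ ≡ ECT.s D ⟨ γ ⟩))

  record Rule : Set₁ where
    field
      Z   : V → Set
      lhs : Term
      rhs : Term
      con : Term

  VarRule : Rule → V → Set
  VarRule ρ x = x ∈ vars (Rule.lhs ρ) ⊎ x ∈ vars (Rule.rhs ρ) ⊎ x ∈ vars (Rule.con ρ)

  ExVar : Rule → V → Set
  ExVar ρ x = x ∈ vars (Rule.rhs ρ) × x ∉ vars (Rule.lhs ρ)

  WF-Rule : Rule → Set
  WF-Rule ρ = Σ Sort (λ τ → WS lhs τ × WS rhs τ)
            × LogicalConstraint con
            × (∀ x → ExVar ρ x ⊎ x ∈ vars con → Z x)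
            × (∀ x → Z x → VarRule ρ x)
    where open Rule ρ

  LeftLinear : Rule → Set
  LeftLinear ρ = Linear (Rule.lhs ρ)

  IsVariant : Rule → Rule → Set
  IsVariant ρ ρ₀ = Σ (V → V) (λ δ → Renaming δ
      × Rule.lhs ρ ≡ Rule.lhs ρ₀ ⟨ (λ x → var (δ x)) ⟩
      × Rule.rhs ρ ≡ Rule.rhs ρ₀ ⟨ (λ x → var (δ x)) ⟩
      × Rule.con ρ ≡ Rule.con ρ₀ ⟨ (λ x → var (δ x)) ⟩
      × (∀ x → Rule.Z ρ x iff Σ V (λ z → Rule.Z ρ₀ z × δ z ≡ x)))

  Disjoint : Rule → ECT → Set
  Disjoint ρ C = ∀ x → VarRule ρ x → ¬ (x ∈ vars (ECT.s C) ⊎ x ∈ vars (ECT.φ C))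

  Step : ECT → Rule → Pos → ECT → Set
  Step C ρ p D =
      SatisfiableECT C × WF-Rule ρ × LeftLinear ρ × Disjoint ρ C × p ∈Pos ECT.s C
    × Σ Subst (λ γ → SortPres γ
        × (∀ x → (γ x ≢ var x) iff (x ∈ vars (Rule.lhs ρ)))
        × subtermAt (ECT.s C) p ≡ just (Rule.lhs ρ ⟨ γ ⟩)
        × (∀ x → x ∈ vars (Rule.lhs ρ) → Rule.Z ρ x →
             IsValTerm (γ x) ⊎ Σ V (λ y → γ x ≡ var y × ECT.X C y))
        × Σ (List V) (λ zs →
              (∀ x → x ∈ zs iff (x ∈ vars (Rule.con ρ) × x ∉ vars (Rule.lhs ρ)))
            × (∀ ξ → HoldsEx ξ (ECT.xs C) (ECT.φ C) → HoldsEx ξ zs (Rule.con ρ ⟨ γ ⟩)))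
        × ECT.s D ≡ replaceAt (ECT.s C) p (Rule.rhs ρ ⟨ γ ⟩)
        × ECT.φ D ≡ app andS (ECT.φ C ∷ (Rule.con ρ ⟨ γ ⟩) ∷ [])
        × (∀ x → x ∈ ECT.xs D iff (x ∈ vars (ECT.φ D) × x ∉ vars (ECT.s D)))
        × (∀ x → ECT.X D x iff (ExVar ρ x ⊎ (ECT.X C x × x ∈ vars (ECT.s D)))))

{-# OPTIONS --safe #-}
module Submission where

-- Both steps rewrite the same subterm s|p = ℓγ = ℓ′γ′ with variants ρ = ρ₀δ and ρ′ = ρ₀δ′,
-- so the matchers agree up to renaming: γ′(δ′x) = γ(δx) on Var(ℓ₀), and outside Var(ℓ)
-- (resp. Var(ℓ′)) they are the identity.  Hence the variable map κ that sends δ′x to δx and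
-- fixes Var(s, φ) turns the second result into the first: t′κ = t and ψ′κ = ψ.  Since both
-- rules are disjoint from (s, φ), κ is injective on the variables of (t′, ψ′), so it maps the
-- bound variables of ψ′ to bound variables of ψ and the free ones to free ones.  Every
-- instance σ of the first result therefore yields the instance σ ∘ κ of the second with the
-- same term, and exchanging the roles of ρ and ρ′ gives the converse.

open import Defs
open import Data.Nat using (zero; suc)
open import Data.List using (List; []; _∷_; _++_)
open import Data.List.Membership.Propositional using (_∈_; _∉_)
open import Data.List.Membership.Propositional.Properties using (∈-++⁺ˡ; ∈-++⁺ʳ; ∈-++⁻)
open import Data.List.Properties using (∷-injectiveˡ; ∷-injectiveʳ)
open import Data.List.Relation.Unary.Any using (here)
open import Data.Maybe using (just)
open import Data.Maybe.Properties using (just-injective)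
open import Data.Product using (Σ; ∃-syntax; _×_; _,_; proj₁; proj₂; map₁; map₂)
open import Data.Sum using (_⊎_; inj₁; inj₂; [_,_])
import Data.Sum as Sum
open import Data.Empty using (⊥-elim)
open import Function using (_∘_; id)
open import Function.Definitions using (Injective)
open import Relation.Nullary using (Dec; yes; no)
open import Relation.Nullary.Decidable using (decidable-stable; map′)
open import Relation.Binary.PropositionalEquality
  using (_≡_; _≢_; refl; sym; trans; cong; cong₂; subst; module ≡-Reasoning)

module _ (S : Signature) (M : Model S) where
  open Theory S M
  open import Data.List.Membership.DecPropositional _≟V_ using (_∈?_)

  ren : (V → V) → Subst
  ren f x = var (f x)

  _⊙_ : Subst → Subst → Subst
  (θ ⊙ θ′) x = θ x ⟨ θ′ ⟩

  ⟨⟩-⊙  : ∀ t θ θ′ → t ⟨ θ ⟩ ⟨ θ′ ⟩ ≡ t ⟨ θ ⊙ θ′ ⟩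
  ⟨⟩L-⊙ : ∀ ts θ θ′ → ts ⟨ θ ⟩L ⟨ θ′ ⟩L ≡ ts ⟨ θ ⊙ θ′ ⟩L
  ⟨⟩-⊙ (var x)    θ θ′ = refl
  ⟨⟩-⊙ (app f ts) θ θ′ = cong (app f) (⟨⟩L-⊙ ts θ θ′)
  ⟨⟩L-⊙ []       θ θ′ = refl
  ⟨⟩L-⊙ (t ∷ ts) θ θ′ = cong₂ _∷_ (⟨⟩-⊙ t θ θ′) (⟨⟩L-⊙ ts θ θ′)

  ⟨⟩-cong  : ∀ t {θ θ′} → (∀ x → x ∈ vars t → θ x ≡ θ′ x) → t ⟨ θ ⟩ ≡ t ⟨ θ′ ⟩
  ⟨⟩L-cong : ∀ ts {θ θ′} → (∀ x → x ∈ varsL ts → θ x ≡ θ′ x) → ts ⟨ θ ⟩L ≡ ts ⟨ θ′ ⟩L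
  ⟨⟩-cong (var x)    eq = eq x (here refl)
  ⟨⟩-cong (app f ts) eq = cong (app f) (⟨⟩L-cong ts eq)
  ⟨⟩L-cong []       eq = refl
  ⟨⟩L-cong (t ∷ ts) eq = cong₂ _∷_ (⟨⟩-cong t (λ x → eq x ∘ ∈-++⁺ˡ))
                                   (⟨⟩L-cong ts (λ x → eq x ∘ ∈-++⁺ʳ (vars t)))

  app-injectiveʳ : ∀ {f g ts us} → app f ts ≡ app g us → ts ≡ us
  app-injectiveʳ refl = refl

  ⟨⟩-cong⁻  : ∀ t {θ θ′} → t ⟨ θ ⟩ ≡ t ⟨ θ′ ⟩ → ∀ {x} → x ∈ vars t → θ x ≡ θ′ x
  ⟨⟩L-cong⁻ : ∀ ts {θ θ′} → ts ⟨ θ ⟩L ≡ ts ⟨ θ′ ⟩L → ∀ {x} → x ∈ varsL ts → θ x ≡ θ′ x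
  ⟨⟩-cong⁻ (var y)    eq (here refl) = eq
  ⟨⟩-cong⁻ (app f ts) eq x∈ = ⟨⟩L-cong⁻ ts (app-injectiveʳ eq) x∈
  ⟨⟩L-cong⁻ (t ∷ ts) eq x∈ with ∈-++⁻ (vars t) x∈
  ... | inj₁ x∈t  = ⟨⟩-cong⁻ t (∷-injectiveˡ eq) x∈t
  ... | inj₂ x∈ts = ⟨⟩L-cong⁻ ts (∷-injectiveʳ eq) x∈ts

  ⟨⟩-identity  : ∀ t → t ⟨ var ⟩ ≡ t
  ⟨⟩L-identity : ∀ ts → ts ⟨ var ⟩L ≡ ts
  ⟨⟩-identity (var x)    = refl
  ⟨⟩-identity (app f ts) = cong (app f) (⟨⟩L-identity ts)
  ⟨⟩L-identity []       = refl
  ⟨⟩L-identity (t ∷ ts) = cong₂ _∷_ (⟨⟩-identity t) (⟨⟩L-identity ts)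

  ⟨⟩-fixed : ∀ t {θ} → (∀ x → x ∈ vars t → θ x ≡ var x) → t ⟨ θ ⟩ ≡ t
  ⟨⟩-fixed t fixed = trans (⟨⟩-cong t fixed) (⟨⟩-identity t)

  value-⟨⟩ : ∀ {t} θ → IsValTerm t → t ⟨ θ ⟩ ≡ t
  value-⟨⟩ θ (v , _ , refl) = refl

  ∈-vars-⟨⟩⁺  : ∀ t θ {x y} → x ∈ vars t → y ∈ vars (θ x) → y ∈ vars (t ⟨ θ ⟩)
  ∈-varsL-⟨⟩⁺ : ∀ ts θ {x y} → x ∈ varsL ts → y ∈ vars (θ x) → y ∈ varsL (ts ⟨ θ ⟩L)
  ∈-vars-⟨⟩⁺ (var x)    θ (here refl) y∈ = y∈
  ∈-vars-⟨⟩⁺ (app f ts) θ x∈ y∈ = ∈-varsL-⟨⟩⁺ ts θ x∈ y∈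
  ∈-varsL-⟨⟩⁺ (t ∷ ts) θ x∈ y∈ with ∈-++⁻ (vars t) x∈
  ... | inj₁ x∈t  = ∈-++⁺ˡ (∈-vars-⟨⟩⁺ t θ x∈t y∈)
  ... | inj₂ x∈ts = ∈-++⁺ʳ (vars (t ⟨ θ ⟩)) (∈-varsL-⟨⟩⁺ ts θ x∈ts y∈)

  ∈-vars-⟨⟩⁻  : ∀ t θ {y} → y ∈ vars (t ⟨ θ ⟩) → ∃[ x ] x ∈ vars t × y ∈ vars (θ x)
  ∈-varsL-⟨⟩⁻ : ∀ ts θ {y} → y ∈ varsL (ts ⟨ θ ⟩L) → ∃[ x ] x ∈ varsL ts × y ∈ vars (θ x)
  ∈-vars-⟨⟩⁻ (var x)    θ y∈ = x , here refl , y∈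
  ∈-vars-⟨⟩⁻ (app f ts) θ y∈ = ∈-varsL-⟨⟩⁻ ts θ y∈
  ∈-varsL-⟨⟩⁻ (t ∷ ts) θ y∈ with ∈-++⁻ (vars (t ⟨ θ ⟩)) y∈
  ... | inj₁ y∈t  = map₂ (map₁ ∈-++⁺ˡ) (∈-vars-⟨⟩⁻ t θ y∈t)
  ... | inj₂ y∈ts = map₂ (map₁ (∈-++⁺ʳ (vars t))) (∈-varsL-⟨⟩⁻ ts θ y∈ts)

  ∈-vars-ren⁺ : ∀ t f {u} → t ⟨ ren f ⟩ ≡ u → ∀ {x} → x ∈ vars t → f x ∈ vars u
  ∈-vars-ren⁺ t f refl x∈ = ∈-vars-⟨⟩⁺ t (ren f) x∈ (here refl)

  ∈-vars-ren⁻ : ∀ t f {u} → t ⟨ ren f ⟩ ≡ u → ∀ {y} → y ∈ vars u → ∃[ x ] x ∈ vars t × y ≡ f x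
  ∈-vars-ren⁻ t f refl y∈ with ∈-vars-⟨⟩⁻ t (ren f) y∈
  ... | x , x∈ , here y≡fx = x , x∈ , y≡fx

  ∈-vars-subtermAt  : ∀ s p {u y} → subtermAt s p ≡ just u → y ∈ vars u → y ∈ vars s
  ∈-varsL-subtermAt : ∀ ts i p {u y} → subtermAtL ts i p ≡ just u → y ∈ vars u → y ∈ varsL ts
  ∈-vars-subtermAt s          []      refl y∈ = y∈
  ∈-vars-subtermAt (app f ts) (i ∷ p) eq   y∈ = ∈-varsL-subtermAt ts i p eq y∈
  ∈-varsL-subtermAt (t ∷ ts) zero    p eq y∈ = ∈-++⁺ˡ (∈-vars-subtermAt t p eq y∈)
  ∈-varsL-subtermAt (t ∷ ts) (suc i) p eq y∈ = ∈-++⁺ʳ (vars t) (∈-varsL-subtermAt ts i p eq y∈)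

  ∈-vars-replaceAt  : ∀ s p u {y} → y ∈ vars (replaceAt s p u) → y ∈ vars s ⊎ y ∈ vars u
  ∈-varsL-replaceAt : ∀ ts i p u {y} → y ∈ varsL (replaceAtL ts i p u) → y ∈ varsL ts ⊎ y ∈ vars u
  ∈-vars-replaceAt s          []      u y∈ = inj₂ y∈
  ∈-vars-replaceAt (var x)    (i ∷ p) u y∈ = inj₁ y∈
  ∈-vars-replaceAt (app f ts) (i ∷ p) u y∈ = ∈-varsL-replaceAt ts i p u y∈
  ∈-varsL-replaceAt (t ∷ ts) zero p u y∈ with ∈-++⁻ (vars (replaceAt t p u)) y∈
  ... | inj₁ y∈t  = Sum.map₁ ∈-++⁺ˡ (∈-vars-replaceAt t p u y∈t)
  ... | inj₂ y∈ts = inj₁ (∈-++⁺ʳ (vars t) y∈ts)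
  ∈-varsL-replaceAt (t ∷ ts) (suc i) p u y∈ with ∈-++⁻ (vars t) y∈
  ... | inj₁ y∈t  = inj₁ (∈-++⁺ˡ y∈t)
  ... | inj₂ y∈ts = Sum.map₁ (∈-++⁺ʳ (vars t)) (∈-varsL-replaceAt ts i p u y∈ts)

  replaceAt-ren  : ∀ s p u f → replaceAt s p u ⟨ ren f ⟩ ≡ replaceAt (s ⟨ ren f ⟩) p (u ⟨ ren f ⟩)
  replaceAtL-ren : ∀ ts i p u f →
                   replaceAtL ts i p u ⟨ ren f ⟩L ≡ replaceAtL (ts ⟨ ren f ⟩L) i p (u ⟨ ren f ⟩)
  replaceAt-ren s          []      u f = refl
  replaceAt-ren (var x)    (i ∷ p) u f = refl
  replaceAt-ren (app g ts) (i ∷ p) u f = cong (app g) (replaceAtL-ren ts i p u f)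
  replaceAtL-ren []       i       p u f = refl
  replaceAtL-ren (t ∷ ts) zero    p u f = cong (_∷ ts ⟨ ren f ⟩L) (replaceAt-ren t p u f)
  replaceAtL-ren (t ∷ ts) (suc i) p u f = cong (t ⟨ ren f ⟩ ∷_) (replaceAtL-ren ts i p u f)

  var-injective : ∀ {x y} → var x ≡ var y → x ≡ y
  var-injective refl = refl

  _≟var_ : ∀ t x → Dec (t ≡ var x)
  var y    ≟var x = map′ (cong var) var-injective (y ≟V x)
  app f ts ≟var x = no λ ()

  outside-domain : ∀ {γ : Subst} {L : List V} → (∀ x → (γ x ≢ var x) iff (x ∈ L)) →
                   ∀ {x} → x ∉ L → γ x ≡ var x
  outside-domain {γ} dom {x} x∉L = decidable-stable (γ x ≟var x) (x∉L ∘ proj₁ (dom x))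

  without-∈ : ∀ xs σ {x} → x ∈ xs → without xs σ x ≡ var x
  without-∈ xs σ {x} x∈ with x ∈? xs
  ... | yes _  = refl
  ... | no x∉ = ⊥-elim (x∉ x∈)

  without-∉ : ∀ xs σ {x} → x ∉ xs → without xs σ x ≡ σ x
  without-∉ xs σ {x} x∉ with x ∈? xs
  ... | yes x∈ = ⊥-elim (x∉ x∈)
  ... | no _   = refl

  Val-cast : ∀ {σ τ} → σ ≡ τ → Val σ → Val τ
  Val-cast eq (v , v-val , v-sort) = v , v-val , trans v-sort eq

  inst-ren : (κ : V → V) → (∀ y → vsort (κ y) ≡ vsort y) →
             ∀ {xs xs′} → (∀ {y} → y ∈ xs′ → κ y ∈ xs) →
             ∀ vs → Σ ((y : V) → y ∈ xs′ → Val (vsort y))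
                      (λ vs′ → ∀ {y} → y ∈ xs′ → inst xs vs (κ y) ≡ inst xs′ vs′ y)
  inst-ren κ κ-sort {xs} {xs′} bound vs = vs′ , inst-eq
    where
    -- inst reads vs at the membership proof found by _∈?_, and distinct proofs of κ y ∈ xs
    -- (duplicates in xs) may carry distinct values, so vs′ must ask _∈?_ as well.
    vs′ : (y : V) → y ∈ xs′ → Val (vsort y)
    vs′ y y∈ with κ y ∈? xs
    ... | yes κy∈ = Val-cast (κ-sort y) (vs (κ y) κy∈)
    ... | no κy∉  = ⊥-elim (κy∉ (bound y∈))

    inst-eq : ∀ {y} → y ∈ xs′ → inst xs vs (κ y) ≡ inst xs′ vs′ y
    inst-eq {y} y∈ with y ∈? xs′
    ... | no y∉ = ⊥-elim (y∉ y∈)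
    ... | yes _ with κ y ∈? xs
    ...   | yes _  = refl
    ...   | no κy∉ = ⊥-elim (κy∉ (bound y∈))

  InjectiveOn : (V → Set) → (V → V) → Set
  InjectiveOn P f = ∀ {x y} → P x → P y → f x ≡ f y → x ≡ y

  fixing : List V → (V → V) → V → V
  fixing A β y with y ∈? A
  ... | yes _ = y
  ... | no _  = β y

  fixing-∈ : ∀ {A β y} → y ∈ A → fixing A β y ≡ y
  fixing-∈ {A} {β} {y} y∈ with y ∈? A
  ... | yes _  = refl
  ... | no y∉ = ⊥-elim (y∉ y∈)

  fixing-∉ : ∀ {A β y} → y ∉ A → fixing A β y ≡ β y
  fixing-∉ {A} {β} {y} y∉ with y ∈? A
  ... | yes y∈ = ⊥-elim (y∉ y∈)
  ... | no _   = refl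

  fixing-sort : ∀ {A β} → (∀ y → vsort (β y) ≡ vsort y) → ∀ y → vsort (fixing A β y) ≡ vsort y
  fixing-sort {A} {β} β-sort y with y ∈? A
  ... | yes _ = refl
  ... | no _  = β-sort y

  fixing-injectiveOn : ∀ {A β} {B : V → Set} → Injective _≡_ _≡_ β → (∀ {y} → B y → β y ∉ A) →
                       InjectiveOn (λ y → y ∈ A ⊎ B y) (fixing A β)
  fixing-injectiveOn {A} {β} {B} β-inj avoids {x} {y} x∈AB y∈AB eq with x ∈? A | y ∈? A
  ... | yes _  | yes _  = eq
  ... | yes x∈ | no y∉  = ⊥-elim (avoids {y} ([ ⊥-elim ∘ y∉ , id ] y∈AB) (subst (_∈ A) eq x∈))
  ... | no x∉  | yes y∈ = ⊥-elim (avoids {x} ([ ⊥-elim ∘ x∉ , id ] x∈AB) (subst (_∈ A) (sym eq) y∈))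
  ... | no _   | no _   = β-inj eq

  infix 4 _≲_
  _≲_ : ECT → ECT → Set
  C ≲ D = ∀ σ → SortPres σ → Valued (ECT.X C) σ → SatBy σ (ECT.xs C) (ECT.φ C) →
          Σ Subst (λ γ → SortPres γ × Valued (ECT.X D) γ × SatBy γ (ECT.xs D) (ECT.φ D)
                        × ECT.s C ⟨ σ ⟩ ≡ ECT.s D ⟨ γ ⟩)

  ≲-antisym : ∀ {C D} → C ≲ D → D ≲ C → C ∼ D
  ≲-antisym C≲D D≲C = C≲D , λ γ γ-sorts γ-valued γ-sat →
    let (σ , σ-sorts , σ-valued , σ-sat , eq) = D≲C γ γ-sorts γ-valued γ-sat
    in σ , σ-sorts , σ-valued , σ-sat , sym eq

  BoundVarsExact : ECT → Set
  BoundVarsExact C = ∀ x → x ∈ ECT.xs C iff (x ∈ vars (ECT.φ C) × x ∉ vars (ECT.s C))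

  VarsOf : ECT → V → Set
  VarsOf C x = x ∈ vars (ECT.s C) ⊎ x ∈ vars (ECT.φ C)

  module ≲-ByRenaming {D D′ : ECT} (κ : V → V) (κ-sort : ∀ y → vsort (κ y) ≡ vsort y)
    (κ-injective : InjectiveOn (VarsOf D′) κ)
    (s′κ : ECT.s D′ ⟨ ren κ ⟩ ≡ ECT.s D) (φ′κ : ECT.φ D′ ⟨ ren κ ⟩ ≡ ECT.φ D)
    (X′⇒X : ∀ y → ECT.X D′ y → ECT.X D (κ y))
    (exact : BoundVarsExact D) (exact′ : BoundVarsExact D′) where

    open ECT D
    open ECT D′ renaming (X to X′; s to s′; xs to xs′; φ to φ′)

    ∈s⇒∈s′ : ∀ {y} → y ∈ vars φ′ → κ y ∈ vars s → y ∈ vars s′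
    ∈s⇒∈s′ {y} y∈φ′ κy∈s with ∈-vars-ren⁻ s′ κ s′κ κy∈s
    ... | y′ , y′∈s′ , κy≡κy′ =
      subst (_∈ vars s′) (κ-injective (inj₁ y′∈s′) (inj₂ y∈φ′) (sym κy≡κy′)) y′∈s′

    free⇒∈s′ : ∀ {y} → y ∈ vars φ′ → y ∉ xs′ → y ∈ vars s′
    free⇒∈s′ {y} y∈φ′ y∉xs′ =
      decidable-stable (y ∈? vars s′) (λ y∉s′ → y∉xs′ (proj₂ (exact′ y) (y∈φ′ , y∉s′)))

    bound⇒bound : ∀ {y} → y ∈ xs′ → κ y ∈ xs
    bound⇒bound {y} y∈xs′ with proj₁ (exact′ y) y∈xs′
    ... | y∈φ′ , y∉s′ = proj₂ (exact (κ y)) (∈-vars-ren⁺ φ′ κ φ′κ y∈φ′ , y∉s′ ∘ ∈s⇒∈s′ y∈φ′)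

    free⇒free : ∀ {y} → y ∈ vars φ′ → y ∉ xs′ → κ y ∉ xs
    free⇒free y∈φ′ y∉xs′ κy∈xs =
      proj₂ (proj₁ (exact _) κy∈xs) (∈-vars-ren⁺ s′ κ s′κ (free⇒∈s′ y∈φ′ y∉xs′))

    module _ (σ : Subst) (σ-free : ∀ x → x ∈ vars φ → x ∉ xs → IsValTerm (σ x)) where

      σκ-free : ∀ y → y ∈ vars φ′ → y ∉ xs′ → IsValTerm (σ (κ y))
      σκ-free y y∈φ′ y∉xs′ = σ-free (κ y) (∈-vars-ren⁺ φ′ κ φ′κ y∈φ′) (free⇒free y∈φ′ y∉xs′)

      module _ {vs vs′} (inst-eq : ∀ {y} → y ∈ xs′ → inst xs vs (κ y) ≡ inst xs′ vs′ y) where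
        open ≡-Reasoning

        closes-alike : ∀ y → y ∈ vars φ′ → Dec (y ∈ xs′) →
          without xs σ (κ y) ⟨ inst xs vs ⟩ ≡ without xs′ (σ ∘ κ) y ⟨ inst xs′ vs′ ⟩
        closes-alike y _ (yes y∈xs′) = begin
          without xs σ (κ y) ⟨ inst xs vs ⟩
            ≡⟨ cong (_⟨ inst xs vs ⟩) (without-∈ xs σ (bound⇒bound y∈xs′)) ⟩
          inst xs vs (κ y)
            ≡⟨ inst-eq y∈xs′ ⟩
          inst xs′ vs′ y
            ≡⟨ cong (_⟨ inst xs′ vs′ ⟩) (without-∈ xs′ (σ ∘ κ) y∈xs′) ⟨
          without xs′ (σ ∘ κ) y ⟨ inst xs′ vs′ ⟩
            ∎
        closes-alike y y∈φ′ (no y∉xs′) = begin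
          without xs σ (κ y) ⟨ inst xs vs ⟩
            ≡⟨ cong (_⟨ inst xs vs ⟩) (without-∉ xs σ (free⇒free y∈φ′ y∉xs′)) ⟩
          σ (κ y) ⟨ inst xs vs ⟩
            ≡⟨ value-⟨⟩ (inst xs vs) (σκ-free y y∈φ′ y∉xs′) ⟩
          σ (κ y)
            ≡⟨ value-⟨⟩ (inst xs′ vs′) (σκ-free y y∈φ′ y∉xs′) ⟨
          σ (κ y) ⟨ inst xs′ vs′ ⟩
            ≡⟨ cong (_⟨ inst xs′ vs′ ⟩) (without-∉ xs′ (σ ∘ κ) y∉xs′) ⟨
          without xs′ (σ ∘ κ) y ⟨ inst xs′ vs′ ⟩
            ∎

        closed-instances-agree :
          φ ⟨ without xs σ ⟩ ⟨ inst xs vs ⟩ ≡ φ′ ⟨ without xs′ (σ ∘ κ) ⟩ ⟨ inst xs′ vs′ ⟩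
        closed-instances-agree = begin
          φ ⟨ without xs σ ⟩ ⟨ inst xs vs ⟩
            ≡⟨ cong (λ u → u ⟨ without xs σ ⟩ ⟨ inst xs vs ⟩) φ′κ ⟨
          φ′ ⟨ ren κ ⟩ ⟨ without xs σ ⟩ ⟨ inst xs vs ⟩
            ≡⟨ cong (_⟨ inst xs vs ⟩) (⟨⟩-⊙ φ′ (ren κ) (without xs σ)) ⟩
          φ′ ⟨ ren κ ⊙ without xs σ ⟩ ⟨ inst xs vs ⟩
            ≡⟨ ⟨⟩-⊙ φ′ (ren κ ⊙ without xs σ) (inst xs vs) ⟩
          φ′ ⟨ (ren κ ⊙ without xs σ) ⊙ inst xs vs ⟩
            ≡⟨ ⟨⟩-cong φ′ (λ y y∈φ′ → closes-alike y y∈φ′ (y ∈? xs′)) ⟩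
          φ′ ⟨ without xs′ (σ ∘ κ) ⊙ inst xs′ vs′ ⟩
            ≡⟨ ⟨⟩-⊙ φ′ (without xs′ (σ ∘ κ)) (inst xs′ vs′) ⟨
          φ′ ⟨ without xs′ (σ ∘ κ) ⟩ ⟨ inst xs′ vs′ ⟩
            ∎

    covers : D ≲ D′
    covers σ σ-sorts σ-valued (σ-free , σ-valid) =
      σ ∘ κ , σκ-sorts , σκ-valued , (σκ-free σ σ-free , σκ-valid) , s-eq
      where
      σκ-sorts : SortPres (σ ∘ κ)
      σκ-sorts y = subst (WS (σ (κ y))) (κ-sort y) (σ-sorts (κ y))

      σκ-valued : Valued X′ (σ ∘ κ)
      σκ-valued y = σ-valued (κ y) ∘ X′⇒X y

      σκ-valid : ValidEx xs′ (φ′ ⟨ without xs′ (σ ∘ κ) ⟩)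
      σκ-valid ξ with σ-valid ξ
      ... | vs , holds with inst-ren κ κ-sort bound⇒bound vs
      ...   | vs′ , inst-eq = vs′ , subst (Holds ξ) (closed-instances-agree σ σ-free inst-eq) holds

      s-eq : s ⟨ σ ⟩ ≡ s′ ⟨ σ ∘ κ ⟩
      s-eq = trans (cong (_⟨ σ ⟩) (sym s′κ)) (⟨⟩-⊙ s′ (ren κ) σ)

  record Matches (γ : Subst) (ℓ s : Term) (p : Pos) : Set where
    field
      domain : ∀ x → (γ x ≢ var x) iff (x ∈ vars ℓ)
      at     : subtermAt s p ≡ just (ℓ ⟨ γ ⟩)

  module _ {γ ℓ s p} (match : Matches γ ℓ s p) where

    matched-∈-vars : ∀ {z y} → z ∈ vars ℓ → y ∈ vars (γ z) → y ∈ vars s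
    matched-∈-vars z∈ℓ y∈ = ∈-vars-subtermAt s p (Matches.at match) (∈-vars-⟨⟩⁺ ℓ γ z∈ℓ y∈)

    unmatched : ∀ {z} → z ∉ vars ℓ → γ z ≡ var z
    unmatched = outside-domain (Matches.domain match)

    ∈-vars-matched : ∀ u {y} → y ∈ vars (u ⟨ γ ⟩) → y ∈ vars s ⊎ y ∈ vars u
    ∈-vars-matched u {y} y∈ with ∈-vars-⟨⟩⁻ u γ y∈
    ... | z , z∈u , y∈γz with z ∈? vars ℓ
    ...   | yes z∈ℓ = inj₁ (matched-∈-vars z∈ℓ y∈γz)
    ...   | no z∉ℓ with subst (λ w → y ∈ vars w) (unmatched z∉ℓ) y∈γz
    ...     | here refl = inj₂ z∈u

  record Rewrites (C : ECT) (ρ : Rule) (p : Pos) (D : ECT) : Set where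
    field
      disjoint   : Disjoint ρ C
      matcher    : Subst
      matches    : Matches matcher (Rule.lhs ρ) (ECT.s C) p
      reduct     : ECT.s D ≡ replaceAt (ECT.s C) p (Rule.rhs ρ ⟨ matcher ⟩)
      constraint : ECT.φ D ≡ app andS (ECT.φ C ∷ (Rule.con ρ ⟨ matcher ⟩) ∷ [])
      exact      : BoundVarsExact D
      pinned     : ∀ x → ECT.X D x iff (ExVar ρ x ⊎ (ECT.X C x × x ∈ vars (ECT.s D)))

  step⇒rewrites : ∀ {C ρ p D} → Step C ρ p D → Rewrites C ρ p D
  step⇒rewrites
    (_ , _ , _ , disj , _ , γ , _ , dom , at , _ , _ , reduct , constraint , exact , pinned) =
    record { disjoint = disj ; matcher = γ ; matches = record { domain = dom ; at = at }
           ; reduct = reduct ; constraint = constraint ; exact = exact ; pinned = pinned }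

  module Variant {ρ ρ₀ : Rule} (variant : IsVariant ρ ρ₀) where

    δ : V → V
    δ = proj₁ variant

    δ-injective : Injective _≡_ _≡_ δ
    δ-injective = proj₁ (proj₁ (proj₁ (proj₂ variant)))

    δ-sort : ∀ x → vsort (δ x) ≡ vsort x
    δ-sort = proj₂ (proj₁ (proj₂ variant))

    δ⁻¹ : V → V
    δ⁻¹ y = proj₁ (proj₂ (proj₁ (proj₁ (proj₂ variant))) y)

    δ∘δ⁻¹ : ∀ y → δ (δ⁻¹ y) ≡ y
    δ∘δ⁻¹ y = proj₂ (proj₂ (proj₁ (proj₁ (proj₂ variant))) y) refl

    δ⁻¹∘δ : ∀ x → δ⁻¹ (δ x) ≡ x
    δ⁻¹∘δ x = δ-injective (δ∘δ⁻¹ (δ x))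

    δ⁻¹-injective : Injective _≡_ _≡_ δ⁻¹
    δ⁻¹-injective {y} {y′} eq = trans (sym (δ∘δ⁻¹ y)) (trans (cong δ eq) (δ∘δ⁻¹ y′))

    δ⁻¹-sort : ∀ y → vsort (δ⁻¹ y) ≡ vsort y
    δ⁻¹-sort y = trans (sym (δ-sort (δ⁻¹ y))) (cong vsort (δ∘δ⁻¹ y))

    lhs≡ : Rule.lhs ρ₀ ⟨ ren δ ⟩ ≡ Rule.lhs ρ
    lhs≡ = sym (proj₁ (proj₂ (proj₂ variant)))

    rhs≡ : Rule.rhs ρ₀ ⟨ ren δ ⟩ ≡ Rule.rhs ρ
    rhs≡ = sym (proj₁ (proj₂ (proj₂ (proj₂ variant))))

    con≡ : Rule.con ρ₀ ⟨ ren δ ⟩ ≡ Rule.con ρ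
    con≡ = sym (proj₁ (proj₂ (proj₂ (proj₂ (proj₂ variant)))))

    ∈-lhs⁺ : ∀ {x} → x ∈ vars (Rule.lhs ρ₀) → δ x ∈ vars (Rule.lhs ρ)
    ∈-lhs⁺ = ∈-vars-ren⁺ (Rule.lhs ρ₀) δ lhs≡

    ∈-lhs⁻ : ∀ {x} → δ x ∈ vars (Rule.lhs ρ) → x ∈ vars (Rule.lhs ρ₀)
    ∈-lhs⁻ δx∈ with ∈-vars-ren⁻ (Rule.lhs ρ₀) δ lhs≡ δx∈
    ... | x′ , x′∈ , δx≡δx′ = subst (_∈ vars (Rule.lhs ρ₀)) (sym (δ-injective δx≡δx′)) x′∈

    varRule⁺ : ∀ {x} → VarRule ρ₀ x → VarRule ρ (δ x)
    varRule⁺ = Sum.map ∈-lhs⁺ (Sum.map (∈-vars-ren⁺ (Rule.rhs ρ₀) δ rhs≡)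
                                       (∈-vars-ren⁺ (Rule.con ρ₀) δ con≡))

    varRule⁻ : ∀ {y} → VarRule ρ y → ∃[ x ] VarRule ρ₀ x × y ≡ δ x
    varRule⁻ (inj₁ y∈)        = map₂ (map₁ inj₁) (∈-vars-ren⁻ (Rule.lhs ρ₀) δ lhs≡ y∈)
    varRule⁻ (inj₂ (inj₁ y∈)) = map₂ (map₁ (inj₂ ∘ inj₁)) (∈-vars-ren⁻ (Rule.rhs ρ₀) δ rhs≡ y∈)
    varRule⁻ (inj₂ (inj₂ y∈)) = map₂ (map₁ (inj₂ ∘ inj₂)) (∈-vars-ren⁻ (Rule.con ρ₀) δ con≡ y∈)

    exVar⁺ : ∀ {x} → ExVar ρ₀ x → ExVar ρ (δ x)
    exVar⁺ (x∈r₀ , x∉ℓ₀) = ∈-vars-ren⁺ (Rule.rhs ρ₀) δ rhs≡ x∈r₀ , x∉ℓ₀ ∘ ∈-lhs⁻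

    exVar⁻ : ∀ {y} → ExVar ρ y → ∃[ x ] ExVar ρ₀ x × y ≡ δ x
    exVar⁻ (y∈r , y∉ℓ) with ∈-vars-ren⁻ (Rule.rhs ρ₀) δ rhs≡ y∈r
    ... | x , x∈r₀ , refl = x , (x∈r₀ , y∉ℓ ∘ ∈-lhs⁺) , refl

  module SameRedex {C D D′ : ECT} {p : Pos} {ρ₀ ρ ρ′ : Rule}
    (X⊆s : ∀ x → ECT.X C x → x ∈ vars (ECT.s C))
    (variant : IsVariant ρ ρ₀) (variant′ : IsVariant ρ′ ρ₀)
    (step : Rewrites C ρ p D) (step′ : Rewrites C ρ′ p D′) where

    open ECT C using (s; φ)
    open ECT D using () renaming (s to t; φ to ψ)
    open ECT D′ using () renaming (s to t′; φ to ψ′)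
    open Rule ρ₀ using () renaming (lhs to ℓ₀; rhs to r₀; con to π₀)
    open Rewrites step renaming (matcher to γ)
    open Matches using (at)
    open Rewrites step′ using ()
      renaming (disjoint to disjoint′; matcher to γ′; matches to matches′;
      reduct to reduct′; constraint to constraint′; exact to exact′; pinned to pinned′)
    open Variant {ρ} {ρ₀} variant
    open Variant {ρ′} {ρ₀} variant′ using () renaming (δ to δ′; δ⁻¹ to δ′⁻¹; δ⁻¹∘δ to δ′⁻¹∘δ′;
      δ⁻¹-injective to δ′⁻¹-injective; δ⁻¹-sort to δ′⁻¹-sort; ∈-lhs⁻ to ∈-lhs′⁻;
      varRule⁺ to varRule′⁺; varRule⁻ to varRule′⁻; exVar⁻ to exVar′⁻;
      lhs≡ to lhs′≡; rhs≡ to rhs′≡; con≡ to con′≡)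

    varsC : List V
    varsC = vars s ++ vars φ

    β : V → V
    β = δ ∘ δ′⁻¹

    κ : V → V
    κ = fixing varsC β

    κ-sort : ∀ y → vsort (κ y) ≡ vsort y
    κ-sort = fixing-sort {varsC} {β} (λ y → trans (δ-sort (δ′⁻¹ y)) (δ′⁻¹-sort y))

    κ-fixes : ∀ {y} → VarsOf C y → κ y ≡ y
    κ-fixes = fixing-∈ {varsC} {β} ∘ [ ∈-++⁺ˡ , ∈-++⁺ʳ (vars s) ]

    κ-fixes-term : ∀ u → (∀ y → y ∈ vars u → VarsOf C y) → u ⟨ ren κ ⟩ ≡ u
    κ-fixes-term u u⊆C = ⟨⟩-fixed u (λ y → cong var ∘ κ-fixes ∘ u⊆C y)

    κ-δ′ : ∀ {x} → VarRule ρ₀ x → κ (δ′ x) ≡ δ x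
    κ-δ′ {x} x∈ρ₀ = begin
      κ (δ′ x)        ≡⟨ fixing-∉ {varsC} {β} (disjoint′ (δ′ x) (varRule′⁺ x∈ρ₀) ∘ ∈-++⁻ (vars s)) ⟩
      δ (δ′⁻¹ (δ′ x)) ≡⟨ cong δ (δ′⁻¹∘δ′ x) ⟩
      δ x             ∎
      where open ≡-Reasoning

    Relevant : V → Set
    Relevant y = y ∈ varsC ⊎ VarRule ρ′ y

    κ-injective : InjectiveOn Relevant κ
    κ-injective = fixing-injectiveOn {varsC} {β} (δ′⁻¹-injective ∘ δ-injective) β-avoids
      where
      β-avoids : ∀ {y} → VarRule ρ′ y → β y ∉ varsC
      β-avoids y∈ρ′ with varRule′⁻ y∈ρ′
      ... | x , x∈ρ₀ , refl = disjoint (δ x) (varRule⁺ x∈ρ₀) ∘ ∈-++⁻ (vars s)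
                                ∘ subst (_∈ varsC) (cong δ (δ′⁻¹∘δ′ x))

    matchers-agree : ∀ {x} → x ∈ vars ℓ₀ → γ′ (δ′ x) ≡ γ (δ x)
    matchers-agree = ⟨⟩-cong⁻ ℓ₀ (begin
      ℓ₀ ⟨ ren δ′ ⊙ γ′ ⟩    ≡⟨ ⟨⟩-⊙ ℓ₀ (ren δ′) γ′ ⟨
      ℓ₀ ⟨ ren δ′ ⟩ ⟨ γ′ ⟩  ≡⟨ cong (_⟨ γ′ ⟩) lhs′≡ ⟩
      Rule.lhs ρ′ ⟨ γ′ ⟩    ≡⟨ just-injective (trans (sym (at matches′)) (at matches)) ⟩
      Rule.lhs ρ ⟨ γ ⟩      ≡⟨ cong (_⟨ γ ⟩) lhs≡ ⟨
      ℓ₀ ⟨ ren δ ⟩ ⟨ γ ⟩    ≡⟨ ⟨⟩-⊙ ℓ₀ (ren δ) γ ⟩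
      ℓ₀ ⟨ ren δ ⊙ γ ⟩      ∎)
      where open ≡-Reasoning

    κ-γ′ : ∀ {x} → VarRule ρ₀ x → γ′ (δ′ x) ⟨ ren κ ⟩ ≡ γ (δ x)
    κ-γ′ {x} x∈ρ₀ with x ∈? vars ℓ₀
    ... | yes x∈ℓ₀ = begin
      γ′ (δ′ x) ⟨ ren κ ⟩  ≡⟨ cong (_⟨ ren κ ⟩) (matchers-agree x∈ℓ₀) ⟩
      γ (δ x) ⟨ ren κ ⟩
        ≡⟨ κ-fixes-term (γ (δ x)) (λ _ → inj₁ ∘ matched-∈-vars matches (∈-lhs⁺ x∈ℓ₀)) ⟩
      γ (δ x)              ∎
      where open ≡-Reasoning
    ... | no x∉ℓ₀ = begin
      γ′ (δ′ x) ⟨ ren κ ⟩  ≡⟨ cong (_⟨ ren κ ⟩) (unmatched matches′ (x∉ℓ₀ ∘ ∈-lhs′⁻)) ⟩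
      var (κ (δ′ x))       ≡⟨ cong var (κ-δ′ x∈ρ₀) ⟩
      var (δ x)            ≡⟨ unmatched matches (x∉ℓ₀ ∘ ∈-lhs⁻) ⟨
      γ (δ x)              ∎
      where open ≡-Reasoning

    κ-instance : ∀ u₀ {u u′} → u₀ ⟨ ren δ ⟩ ≡ u → u₀ ⟨ ren δ′ ⟩ ≡ u′ →
                 (∀ x → x ∈ vars u₀ → VarRule ρ₀ x) → u′ ⟨ γ′ ⟩ ⟨ ren κ ⟩ ≡ u ⟨ γ ⟩
    κ-instance u₀ refl refl u₀⊆ρ₀ = begin
      u₀ ⟨ ren δ′ ⟩ ⟨ γ′ ⟩ ⟨ ren κ ⟩  ≡⟨ cong (_⟨ ren κ ⟩) (⟨⟩-⊙ u₀ (ren δ′) γ′) ⟩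
      u₀ ⟨ ren δ′ ⊙ γ′ ⟩ ⟨ ren κ ⟩    ≡⟨ ⟨⟩-⊙ u₀ (ren δ′ ⊙ γ′) (ren κ) ⟩
      u₀ ⟨ (ren δ′ ⊙ γ′) ⊙ ren κ ⟩    ≡⟨ ⟨⟩-cong u₀ (λ x → κ-γ′ ∘ u₀⊆ρ₀ x) ⟩
      u₀ ⟨ ren δ ⊙ γ ⟩                ≡⟨ ⟨⟩-⊙ u₀ (ren δ) γ ⟨
      u₀ ⟨ ren δ ⟩ ⟨ γ ⟩              ∎
      where open ≡-Reasoning

    t′κ : t′ ⟨ ren κ ⟩ ≡ t
    t′κ = begin
      t′ ⟨ ren κ ⟩                                  ≡⟨ cong (_⟨ ren κ ⟩) reduct′ ⟩
      replaceAt s p (Rule.rhs ρ′ ⟨ γ′ ⟩) ⟨ ren κ ⟩  ≡⟨ replaceAt-ren s p _ κ ⟩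
      replaceAt (s ⟨ ren κ ⟩) p (Rule.rhs ρ′ ⟨ γ′ ⟩ ⟨ ren κ ⟩)
        ≡⟨ cong₂ (λ s₁ u → replaceAt s₁ p u) (κ-fixes-term s (λ _ → inj₁))
                 (κ-instance r₀ rhs≡ rhs′≡ (λ _ → inj₂ ∘ inj₁)) ⟩
      replaceAt s p (Rule.rhs ρ ⟨ γ ⟩)              ≡⟨ reduct ⟨
      t                                             ∎
      where open ≡-Reasoning

    ψ′κ : ψ′ ⟨ ren κ ⟩ ≡ ψ
    ψ′κ = begin
      ψ′ ⟨ ren κ ⟩                                               ≡⟨ cong (_⟨ ren κ ⟩) constraint′ ⟩
      app andS (φ ⟨ ren κ ⟩ ∷ Rule.con ρ′ ⟨ γ′ ⟩ ⟨ ren κ ⟩ ∷ [])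
        ≡⟨ cong₂ (λ φ₁ u → app andS (φ₁ ∷ u ∷ [])) (κ-fixes-term φ (λ _ → inj₂))
                 (κ-instance π₀ con≡ con′≡ (λ _ → inj₂ ∘ inj₂)) ⟩
      app andS (φ ∷ Rule.con ρ ⟨ γ ⟩ ∷ [])                       ≡⟨ constraint ⟨
      ψ                                                          ∎
      where open ≡-Reasoning

    t′-relevant : ∀ {y} → y ∈ vars t′ → Relevant y
    t′-relevant y∈ with ∈-vars-replaceAt s p _ (subst (λ u → _ ∈ vars u) reduct′ y∈)
    ... | inj₁ y∈s  = inj₁ (∈-++⁺ˡ y∈s)
    ... | inj₂ y∈rγ = Sum.map ∈-++⁺ˡ (inj₂ ∘ inj₁) (∈-vars-matched matches′ (Rule.rhs ρ′) y∈rγ)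

    ψ′-relevant : ∀ {y} → y ∈ vars ψ′ → Relevant y
    ψ′-relevant y∈ with ∈-++⁻ (vars φ) (subst (λ u → _ ∈ vars u) constraint′ y∈)
    ... | inj₁ y∈φ = inj₁ (∈-++⁺ʳ (vars s) y∈φ)
    ... | inj₂ y∈πγ with ∈-++⁻ (vars (Rule.con ρ′ ⟨ γ′ ⟩)) y∈πγ
    ...   | inj₁ y∈πγ′ = Sum.map ∈-++⁺ˡ (inj₂ ∘ inj₂) (∈-vars-matched matches′ (Rule.con ρ′) y∈πγ′)

    X′⇒X : ∀ y → ECT.X D′ y → ECT.X D (κ y)
    X′⇒X y X′y with proj₁ (pinned′ y) X′y
    ... | inj₁ y∈ExVar′ with exVar′⁻ y∈ExVar′
    ...   | x , x∈ExVar₀ , refl = subst (ECT.X D) (sym (κ-δ′ (inj₂ (inj₁ (proj₁ x∈ExVar₀)))))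
                                        (proj₂ (pinned (δ x)) (inj₁ (exVar⁺ x∈ExVar₀)))
    X′⇒X y X′y | inj₂ (Xy , y∈t′) =
      subst (ECT.X D) (sym κy≡y)
            (proj₂ (pinned y) (inj₂ (Xy , subst (_∈ vars t) κy≡y (∈-vars-ren⁺ t′ κ t′κ y∈t′))))
      where
      κy≡y : κ y ≡ y
      κy≡y = κ-fixes (inj₁ (X⊆s y Xy))

    covers : D ≲ D′
    covers = ≲-ByRenaming.covers {D} {D′} κ κ-sort
      (λ y∈ y′∈ → κ-injective (relevant y∈) (relevant y′∈)) t′κ ψ′κ X′⇒X exact exact′
      where
      relevant : ∀ {y} → VarsOf D′ y → Relevant y
      relevant = [ t′-relevant , ψ′-relevant ]

mainTheorem4 : (S : Signature) (M : Model S) → let open Theory S M in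
    (C : ECT) (p : Pos) (ρ₀ ρ ρ′ : Rule) (D D′ : ECT) →
    WF-ECT C → p ∈Pos ECT.s C →
    WF-Rule ρ₀ → LeftLinear ρ₀ → IsVariant ρ ρ₀ → IsVariant ρ′ ρ₀ →
    Disjoint ρ C → Disjoint ρ′ C →
    Step C ρ p D → Step C ρ′ p D′ →
    D ∼ D′
-- Disjointness is also part of each Step.
mainTheorem4 S M C p ρ₀ ρ ρ′ D D′ (_ , _ , _ , X⊆s , _) _ _ _ variant variant′ _ _ step step′ =
  ≲-antisym S M {D} {D′} (SameRedex.covers S M {ρ₀ = ρ₀} X⊆s variant variant′ rewrites rewrites′)
                         (SameRedex.covers S M {ρ₀ = ρ₀} X⊆s variant′ variant rewrites′ rewrites)
  where
  rewrites : Rewrites S M C ρ p D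
  rewrites = step⇒rewrites S M step

  rewrites′ : Rewrites S M C ρ′ p D′
  rewrites′ = step⇒rewrites S M step′
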